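{- Let $n\geq 4$. The initial cost positive semidefinite product throttling number of the cycle $C_n$ is $$\operatorname{th_+^\times}(C_n)=\begin{cases}3\left(1+\left\lceil\frac{n-3}{6}\right\rceil\right) & \text{if } n=12i+3 \text{ for some integer } i\geq 1,\\[2pt] 2\left(1+\left\lceil\frac{n-2}{4}\right\rceil\right) & \text{otherwise.}\end{cases}$$
   Context: All graphs are finite and simple; $C_n$ is the cycle on $n$ vertices. PSD color change rule: given a set $B$ of blue vertices (others white), let $W_1,\dots,W_k$ be the vertex sets of the components of $G-B$; if $u\in B$ and $w\in W_i$ is the only white neighbor of $u$ in $G[W_i\cup B]$, then $u$ can force $w$. For $S\subseteq V(G)$, $S^{[0]}=S$ and $S^{[i]}=S^{[i-1]}\cup\{w\notin S^{[i-1]}: w$ can be forced given blue set $S^{[i-1]}\}$. $S$ is a PSD forcing set if $S^{[i]}=V(G)$ for some $i$; $\operatorname{pt_+}(G;S)$ is the least such $i$ ($\infty$ if none). $\operatorname{Z_+}(G)$ is the minimum size of a PSD forcing set, and $\operatorname{th_+^\times}(G)=\min\{|S|(1+\operatorname{pt_+}(G;S)): S\subseteq V(G),|S|\ge\operatorname{Z_+}(G)\}$. -}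

module Defs where

open import Data.Nat using (ℕ; NonZero; zero; suc; _+_; _*_; _∸_; _≤_; _<_)
open import Data.Nat.DivMod using (_/_)
open import Data.Fin using (Fin; toℕ)
open import Data.Fin.Subset using (Subset; _∈_; _∉_; ∣_∣)
open import Data.Product using (Σ; _×_; ∃; ∃-syntax)
open import Data.Sum using (_⊎_)
open import Relation.Nullary using (¬_)
open import Relation.Binary.PropositionalEquality using (_≡_)
open import Relation.Binary.Construct.Closure.ReflexiveTransitive using (Star)

-- A graph on vertex set Fin n is given by its (symmetric, irreflexive) adjacency
-- relation; all notions below are parametrised by it.

CycleAdj : (n : ℕ) → Fin n → Fin n → Set
CycleAdj n i j =
  (suc (toℕ i) ≡ toℕ j) ⊎ (suc (toℕ j) ≡ toℕ i)
  ⊎ ((toℕ i ≡ 0) × (suc (toℕ j) ≡ n)) ⊎ ((toℕ j ≡ 0) × (suc (toℕ i) ≡ n))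

module _ {n : ℕ} (Adj : Fin n → Fin n → Set) where

  BlueSet : Set₁
  BlueSet = Fin n → Set

  WhiteEdge : BlueSet → Fin n → Fin n → Set
  WhiteEdge B x y = ¬ B x × ¬ B y × Adj x y

  SameComp : BlueSet → Fin n → Fin n → Set
  SameComp B = Star (WhiteEdge B)

  -- PSD color change rule: u ∈ B can force the white vertex w if w is the
  -- only white neighbour of u in G[W_i ∪ B], W_i the component of G - B containing w.
  CanForce : BlueSet → Fin n → Fin n → Set
  CanForce B u w =
    B u × ¬ B w × Adj u w ×
    (∀ w' → ¬ B w' → SameComp B w w' → Adj u w' → w' ≡ w)

  Forced : BlueSet → Fin n → Set
  Forced B w = ¬ B w × ∃[ u ] CanForce B u w

  Blue : Subset n → ℕ → BlueSet
  Blue S zero v = v ∈ S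
  Blue S (suc i) v = Blue S i v ⊎ Forced (Blue S i) v

  AllBlue : Subset n → ℕ → Set
  AllBlue S i = ∀ v → Blue S i v

  IsPSDForcingSet : Subset n → Set
  IsPSDForcingSet S = ∃[ i ] AllBlue S i

  IsPropTime : Subset n → ℕ → Set
  IsPropTime S p = AllBlue S p × (∀ q → q < p → ¬ AllBlue S q)

  IsZplus : ℕ → Set
  IsZplus z = (∃[ S ] (IsPSDForcingSet S × ∣ S ∣ ≡ z))
            × (∀ S → IsPSDForcingSet S → z ≤ ∣ S ∣)

  AtLeastZplus : Subset n → Set
  AtLeastZplus S = ∀ z → IsZplus z → z ≤ ∣ S ∣

  -- th_+^×(G) = k : minimum of |S|(1 + pt_+(G;S)) over S with |S| ≥ Z_+(G)
  -- (sets with pt_+ = ∞ contribute ∞ and never attain the minimum).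
  IsThrottleX : ℕ → Set
  IsThrottleX k =
    (∃[ S ] ∃[ p ] (AtLeastZplus S × IsPropTime S p × ∣ S ∣ * (1 + p) ≡ k))
    × (∀ S p → AtLeastZplus S → IsPropTime S p → k ≤ ∣ S ∣ * (1 + p))

ceilDiv : ℕ → (b : ℕ) → .{{_ : NonZero b}} → ℕ
ceilDiv a b = (a + (b ∸ 1)) / b

-- Lower bound: a vertex that is blue at time p is joined to a seed by a walk of length at most p;
-- on C_n such a vertex is determined by the seed and a shift in [0, 2p], so n ≤ |S| (1 + 2p).
-- A single blue vertex of C_n can never force, so |S| ≥ 2.  Minimising |S| (1 + p) under these two
-- constraints gives 2 (1 + ⌈(n - 2)/4⌉), except when n = 12i + 3, where three seeds with p = 2i tile
-- the cycle exactly and give 3 (1 + 2i).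
-- Upper bound: once two vertices are blue, every blue vertex can force each white neighbour, so seeds
-- at the centres of windows of length 1 + 2p covering the cycle turn everything blue by time p.
module Submission where

open import Defs
open import Data.Nat
open import Data.Nat.Properties
open import Data.Nat.DivMod
open import Data.Nat.Divisibility using (divides-refl)
open import Data.Nat.Tactic.RingSolver using (solve-∀)
open import Data.Fin using (Fin; toℕ; fromℕ<; combine) renaming (zero to fzero; suc to fsuc)
open import Data.Fin.Properties using (toℕ-injective; toℕ<n; toℕ-fromℕ<; combine-injective; injective⇒≤; any?) renaming (suc-injective to fsuc-injective; _≟_ to _≟ᶠ_)
open import Data.Fin.Subset using (Subset; _∈_; _∉_; ∣_∣; inside; outside; ⁅_⁆; _∪_)
open import Data.Fin.Subset.Properties using (_∈?_; ∪-identityˡ; x∈p∪q⁻; x∈p∪q⁺; x∈⁅x⁆; x∈⁅y⁆⇒x≡y; x≢y⇒x∉⁅y⁆; ∣⁅x⁆∣≡1)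
open import Data.Vec using (_∷_; here; there)
open import Data.Product using (_×_; _,_; proj₁; proj₂; ∃-syntax)
open import Data.Sum using (_⊎_; inj₁; inj₂; [_,_])
open import Function using (_∘_; id)
open import Relation.Nullary using (¬_; Dec; yes; no; contradiction)
open import Relation.Nullary.Decidable using (_×-dec_)
open import Relation.Binary.PropositionalEquality hiding ([_])
open import Relation.Binary.Construct.Closure.ReflexiveTransitive using (ε; _◅_; fold; reverse)

-- Arithmetic of the two ceilings

Special : ℕ → Set
Special n = ∃[ i ] (1 ≤ i × n ≡ 12 * i + 3)

even-or-odd : ∀ p → ∃[ j ] (p ≡ 2 * j ⊎ p ≡ 1 + 2 * j)
even-or-odd zero = 0 , inj₁ refl
even-or-odd (suc p) with even-or-odd p
... | j , inj₁ refl = j , inj₂ refl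
... | j , inj₂ refl = suc j , inj₁ (cong suc (sym (+-suc j (j + 0))))

⌈[n-2]/4⌉ : ℕ → ℕ
⌈[n-2]/4⌉ n = ceilDiv (n ∸ 2) 4

⌈[n-2]/4⌉-upper : ∀ n → n ≤ 4 * ⌈[n-2]/4⌉ n + 2
⌈[n-2]/4⌉-upper 0 = z≤n
⌈[n-2]/4⌉-upper 1 = s≤s z≤n
⌈[n-2]/4⌉-upper (suc (suc m)) = ≤-trans (≤-pred (≤-pred 3+m<4+x*4)) (≤-reflexive (2+x*4≡4x+2 x))
  where
  open ≤-Reasoning
  x = (m + 3) / 4
  3+m<4+x*4 : 3 + m < 4 + x * 4
  3+m<4+x*4 = begin-strict
    3 + m               ≡⟨ +-comm 3 m ⟩
    m + 3               ≡⟨ m≡m%n+[m/n]*n (m + 3) 4 ⟩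
    (m + 3) % 4 + x * 4 <⟨ +-monoˡ-< (x * 4) (m%n<n (m + 3) 4) ⟩
    4 + x * 4           ∎
  2+x*4≡4x+2 : ∀ x → 2 + x * 4 ≡ 4 * x + 2
  2+x*4≡4x+2 = solve-∀

⌈[n-2]/4⌉-least : ∀ {n q} → n ≤ 4 * q + 2 → ⌈[n-2]/4⌉ n ≤ q
⌈[n-2]/4⌉-least {0} _ = z≤n
⌈[n-2]/4⌉-least {1} _ = z≤n
⌈[n-2]/4⌉-least {suc (suc m)} {q} n≤ = ≤-pred (m<n*o⇒m/o<n (begin-strict
  m + 3     ≡⟨ +-comm m 3 ⟩
  3 + m     <⟨ s≤s (+-monoʳ-≤ 3 m≤q*4) ⟩
  4 + q * 4 ∎))
  where
  open ≤-Reasoning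
  m≤q*4 : m ≤ q * 4
  m≤q*4 = begin
    m     ≤⟨ +-cancelʳ-≤ 2 m (4 * q) (≤-trans (≤-reflexive (+-comm m 2)) n≤) ⟩
    4 * q ≡⟨ *-comm 4 q ⟩
    q * 4 ∎

⌈[n-2]/4⌉-lower : ∀ n → 4 * ⌈[n-2]/4⌉ n ≤ 1 + n
⌈[n-2]/4⌉-lower 0 = z≤n
⌈[n-2]/4⌉-lower 1 = z≤n
⌈[n-2]/4⌉-lower (suc (suc m)) = begin
  4 * x ≡⟨ *-comm 4 x ⟩
  x * 4 ≤⟨ m/n*n≤m (m + 3) 4 ⟩
  m + 3 ≡⟨ +-comm m 3 ⟩
  3 + m ∎
  where
  open ≤-Reasoning
  x = (m + 3) / 4

⌈[n-2]/4⌉-room : ∀ {n} → 4 ≤ n → 2 * ⌈[n-2]/4⌉ n + 2 ≤ n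
⌈[n-2]/4⌉-room {n} 4≤n = ≤-pred (*-cancelˡ-< 2 _ _ (begin-strict
  2 * (2 * x + 2) ≡⟨ 2[2x+2]≡4x+4 x ⟩
  4 * x + 4       ≤⟨ +-monoˡ-≤ 4 (⌈[n-2]/4⌉-lower n) ⟩
  1 + n + 4       ≡⟨ +-comm (1 + n) 4 ⟩
  5 + n           ≡⟨ +-comm 5 n ⟩
  n + 5           <⟨ +-monoʳ-< n (s≤s (s≤s 4≤n)) ⟩
  n + (2 + n)     ≡⟨ n+[2+n]≡2[1+n] n ⟩
  2 * (1 + n)     ∎))
  where
  open ≤-Reasoning
  x = ⌈[n-2]/4⌉ n
  2[2x+2]≡4x+4 : ∀ x → 2 * (2 * x + 2) ≡ 4 * x + 4
  2[2x+2]≡4x+4 = solve-∀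
  n+[2+n]≡2[1+n] : ∀ n → n + (2 + n) ≡ 2 * (1 + n)
  n+[2+n]≡2[1+n] = solve-∀

⌈[n-3]/6⌉-special : ∀ i → ceilDiv (12 * i + 3 ∸ 3) 6 ≡ 2 * i
⌈[n-3]/6⌉-special i = begin
  (12 * i + 3 ∸ 3 + 5) / 6    ≡⟨ cong (λ m → (m + 5) / 6) (m+n∸n≡m (12 * i) 3) ⟩
  (12 * i + 5) / 6            ≡⟨ cong (λ m → (m + 5) / 6) (12i≡2i*6 i) ⟩
  (2 * i * 6 + 5) / 6         ≡⟨ +-distrib-/-∣ˡ 5 (divides-refl (2 * i)) ⟩
  2 * i * 6 / 6 + 5 / 6       ≡⟨ cong (_+ 0) (m*n/n≡m (2 * i) 6) ⟩
  2 * i + 0                   ≡⟨ +-identityʳ (2 * i) ⟩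
  2 * i                       ∎
  where
  open ≡-Reasoning
  12i≡2i*6 : ∀ i → 12 * i ≡ 2 * i * 6
  12i≡2i*6 = solve-∀

halve-≤ : ∀ {n k p a} → n ≤ k * (1 + 2 * p) → 2 * a ≤ n + k → a ≤ k * (1 + p)
halve-≤ {n} {k} {p} {a} n≤ 2a≤ = *-cancelˡ-≤ 2 (begin
  2 * a               ≤⟨ 2a≤ ⟩
  n + k               ≤⟨ +-monoˡ-≤ k n≤ ⟩
  k * (1 + 2 * p) + k ≡⟨ k[1+2p]+k≡2[k[1+p]] k p ⟩
  2 * (k * (1 + p))   ∎)
  where
  open ≤-Reasoning
  k[1+2p]+k≡2[k[1+p]] : ∀ k p → k * (1 + 2 * p) + k ≡ 2 * (k * (1 + p))
  k[1+2p]+k≡2[k[1+p]] = solve-∀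

2[1+2p]≡4p+2 : ∀ p → 2 * (1 + 2 * p) ≡ 4 * p + 2
2[1+2p]≡4p+2 = solve-∀

2[1+⌈[n-2]/4⌉]≤-via : ∀ {n b} q → n ≤ 4 * q + 2 → 2 * (1 + q) ≤ b → 2 * (1 + ⌈[n-2]/4⌉ n) ≤ b
2[1+⌈[n-2]/4⌉]≤-via q n≤ le = ≤-trans (*-monoʳ-≤ 2 (s≤s (⌈[n-2]/4⌉-least n≤))) le

≡12i+3⇒special : ∀ {n i} → 4 ≤ n → n ≡ 12 * i + 3 → Special n
≡12i+3⇒special {i = zero} 4≤n refl = contradiction 4≤n λ { (s≤s (s≤s (s≤s ()))) }
≡12i+3⇒special {i = suc i} _ n≡ = suc i , s≤s z≤n , n≡

-- The only obstruction is p = 2j and n = 12j + 3, where ⌈(n - 2)/4⌉ = 3j + 1 and 2 (3j + 2) > 3 (1 + 2j).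
nonSpecial-bound₃ : ∀ {n p} → 4 ≤ n → ¬ Special n → n ≤ 3 * (1 + 2 * p) → 2 * (1 + ⌈[n-2]/4⌉ n) ≤ 3 * (1 + p)
nonSpecial-bound₃ {n} {p} 4≤n ¬special n≤ with even-or-odd p
... | j , inj₂ refl = 2[1+⌈[n-2]/4⌉]≤-via (2 + 3 * j)
  (≤-trans n≤ (≤-trans (m≤m+n _ 1) (≤-reflexive (3[3+4j]+1≡4[2+3j]+2 j)))) (≤-reflexive (2[3+3j]≡3[2+2j] j))
  where
  3[3+4j]+1≡4[2+3j]+2 : ∀ j → 3 * (1 + 2 * (1 + 2 * j)) + 1 ≡ 4 * (2 + 3 * j) + 2
  3[3+4j]+1≡4[2+3j]+2 = solve-∀
  2[3+3j]≡3[2+2j] : ∀ j → 2 * (1 + (2 + 3 * j)) ≡ 3 * (1 + (1 + 2 * j))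
  2[3+3j]≡3[2+2j] = solve-∀
... | j , inj₁ refl with n ≟ 12 * j + 3
...   | yes n≡ = contradiction (≡12i+3⇒special {i = j} 4≤n n≡) ¬special
...   | no n≢ = 2[1+⌈[n-2]/4⌉]≤-via (3 * j)
  (≤-pred (≤-trans (≤∧≢⇒< (≤-trans n≤ (≤-reflexive (3[1+4j]≡12j+3 j))) n≢) (≤-reflexive (12j+3≡1+4[3j]+2 j))))
  (≤-trans (m≤m+n _ 1) (≤-reflexive (2[1+3j]+1≡3[1+2j] j)))
  where
  3[1+4j]≡12j+3 : ∀ j → 3 * (1 + 2 * (2 * j)) ≡ 12 * j + 3
  3[1+4j]≡12j+3 = solve-∀
  12j+3≡1+4[3j]+2 : ∀ j → 12 * j + 3 ≡ suc (4 * (3 * j) + 2)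
  12j+3≡1+4[3j]+2 = solve-∀
  2[1+3j]+1≡3[1+2j] : ∀ j → 2 * (1 + 3 * j) + 1 ≡ 3 * (1 + 2 * j)
  2[1+3j]+1≡3[1+2j] = solve-∀

nonSpecial-bound : ∀ {n k p} → 4 ≤ n → ¬ Special n → 2 ≤ k → n ≤ k * (1 + 2 * p) →
                   2 * (1 + ⌈[n-2]/4⌉ n) ≤ k * (1 + p)
nonSpecial-bound {k = 1} _ _ (s≤s ()) _
nonSpecial-bound {k = 2} {p} _ _ _ n≤ = 2[1+⌈[n-2]/4⌉]≤-via p (≤-trans n≤ (≤-reflexive (2[1+2p]≡4p+2 p))) ≤-refl
nonSpecial-bound {k = 3} 4≤n ¬special _ n≤ = nonSpecial-bound₃ 4≤n ¬special n≤
nonSpecial-bound {k = 4} {p} _ _ _ n≤ = 2[1+⌈[n-2]/4⌉]≤-via (1 + 2 * p)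
  (≤-trans n≤ (m≤m+n _ 2)) (≤-reflexive (2[2+2p]≡4[1+p] p))
  where
  2[2+2p]≡4[1+p] : ∀ p → 2 * (1 + (1 + 2 * p)) ≡ 4 * (1 + p)
  2[2+2p]≡4[1+p] = solve-∀
nonSpecial-bound {n} {k@(suc (suc (suc (suc (suc _)))))} _ _ _ n≤ = halve-≤ n≤ (begin
  2 * (2 * (1 + x)) ≡⟨ 2[2[1+x]]≡4x+4 x ⟩
  4 * x + 4         ≤⟨ +-monoˡ-≤ 4 (⌈[n-2]/4⌉-lower n) ⟩
  1 + n + 4         ≡⟨ +-comm (1 + n) 4 ⟩
  5 + n             ≡⟨ +-comm 5 n ⟩
  n + 5             ≤⟨ +-monoʳ-≤ n (s≤s (s≤s (s≤s (s≤s (s≤s z≤n))))) ⟩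
  n + k             ∎)
  where
  open ≤-Reasoning
  x = ⌈[n-2]/4⌉ n
  2[2[1+x]]≡4x+4 : ∀ x → 2 * (2 * (1 + x)) ≡ 4 * x + 4
  2[2[1+x]]≡4x+4 = solve-∀

special-bound : ∀ {i k p} → 2 ≤ k → 12 * i + 3 ≤ k * (1 + 2 * p) → 3 * (1 + 2 * i) ≤ k * (1 + p)
special-bound {k = 1} (s≤s ()) _
special-bound {i} {2} {p} _ n≤ = begin
  3 * (1 + 2 * i)     ≤⟨ m≤m+n _ 1 ⟩
  3 * (1 + 2 * i) + 1 ≡⟨ 3[1+2i]+1≡2[2+3i] i ⟩
  2 * (2 + 3 * i)     ≤⟨ *-monoʳ-≤ 2 (s≤s 3i<p) ⟩
  2 * (1 + p)         ∎
  where
  open ≤-Reasoning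
  3[1+2i]+1≡2[2+3i] : ∀ i → 3 * (1 + 2 * i) + 1 ≡ 2 * (2 + 3 * i)
  3[1+2i]+1≡2[2+3i] = solve-∀
  1+4[3i]+2≡12i+3 : ∀ i → suc (4 * (3 * i)) + 2 ≡ 12 * i + 3
  1+4[3i]+2≡12i+3 = solve-∀
  3i<p : 3 * i < p
  3i<p = *-cancelˡ-< 4 _ _ (+-cancelʳ-≤ 2 _ _
    (≤-trans (≤-reflexive (1+4[3i]+2≡12i+3 i)) (≤-trans n≤ (≤-reflexive (2[1+2p]≡4p+2 p)))))
special-bound {i} {k@(suc (suc (suc _)))} _ n≤ = halve-≤ n≤ (begin
  2 * (3 * (1 + 2 * i)) ≡⟨ 2[3[1+2i]]≡12i+3+3 i ⟩
  12 * i + 3 + 3        ≤⟨ +-monoʳ-≤ (12 * i + 3) (s≤s (s≤s (s≤s z≤n))) ⟩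
  12 * i + 3 + k        ∎)
  where
  open ≤-Reasoning
  2[3[1+2i]]≡12i+3+3 : ∀ i → 2 * (3 * (1 + 2 * i)) ≡ 12 * i + 3 + 3
  2[3[1+2i]]≡12i+3+3 = solve-∀

-- Finite subsets

rank : ∀ {m} {p : Subset m} {x} → x ∈ p → Fin ∣ p ∣
rank {p = inside ∷ p} here = fzero
rank {p = inside ∷ p} (there x∈p) = fsuc (rank x∈p)
rank {p = outside ∷ p} (there x∈p) = rank x∈p

rank-injective : ∀ {m} {p : Subset m} {x y} (x∈p : x ∈ p) (y∈p : y ∈ p) →
                 rank x∈p ≡ rank y∈p → x ≡ y
rank-injective {p = inside ∷ p} here here _ = refl
rank-injective {p = inside ∷ p} (there x∈p) (there y∈p) eq =
  cong fsuc (rank-injective x∈p y∈p (fsuc-injective eq))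
rank-injective {p = outside ∷ p} (there x∈p) (there y∈p) eq = cong fsuc (rank-injective x∈p y∈p eq)

∣p∣≤1⇒∈-unique : ∀ {m} {p : Subset m} {x y} → ∣ p ∣ ≤ 1 → x ∈ p → y ∈ p → x ≡ y
∣p∣≤1⇒∈-unique ∣p∣≤1 x∈p y∈p = rank-injective x∈p y∈p (Fin-unique ∣p∣≤1 (rank x∈p) (rank y∈p))
  where
  Fin-unique : ∀ {k} → k ≤ 1 → (i j : Fin k) → i ≡ j
  Fin-unique {1} _ fzero fzero = refl
  Fin-unique {suc (suc _)} (s≤s ())

∣⁅x⁆∪p∣≡1+∣p∣ : ∀ {m} {x : Fin m} {p : Subset m} → x ∉ p → ∣ ⁅ x ⁆ ∪ p ∣ ≡ suc ∣ p ∣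
∣⁅x⁆∪p∣≡1+∣p∣ {x = fzero} {inside ∷ p} x∉p = contradiction here x∉p
∣⁅x⁆∪p∣≡1+∣p∣ {x = fzero} {outside ∷ p} _ = cong (λ q → suc ∣ q ∣) (∪-identityˡ p)
∣⁅x⁆∪p∣≡1+∣p∣ {x = fsuc x} {inside ∷ p} x∉p = cong suc (∣⁅x⁆∪p∣≡1+∣p∣ (λ x∈p → x∉p (there x∈p)))
∣⁅x⁆∪p∣≡1+∣p∣ {x = fsuc x} {outside ∷ p} x∉p = ∣⁅x⁆∪p∣≡1+∣p∣ (λ x∈p → x∉p (there x∈p))

∣⁅x⁆∪⁅y⁆∣≡2 : ∀ {m} {x y : Fin m} → x ≢ y → ∣ ⁅ x ⁆ ∪ ⁅ y ⁆ ∣ ≡ 2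
∣⁅x⁆∪⁅y⁆∣≡2 {y = y} x≢y = trans (∣⁅x⁆∪p∣≡1+∣p∣ (x≢y⇒x∉⁅y⁆ x≢y)) (cong suc (∣⁅x⁆∣≡1 y))

∣⁅x⁆∪⁅y⁆∪⁅z⁆∣≡3 : ∀ {m} {x y z : Fin m} → x ≢ y → x ≢ z → y ≢ z →
                   ∣ ⁅ x ⁆ ∪ (⁅ y ⁆ ∪ ⁅ z ⁆) ∣ ≡ 3
∣⁅x⁆∪⁅y⁆∪⁅z⁆∣≡3 {y = y} {z} x≢y x≢z y≢z =
  trans (∣⁅x⁆∪p∣≡1+∣p∣ x∉⁅y⁆∪⁅z⁆) (cong suc (∣⁅x⁆∪⁅y⁆∣≡2 y≢z))
  where
  x∉⁅y⁆∪⁅z⁆ : _ ∉ ⁅ y ⁆ ∪ ⁅ z ⁆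
  x∉⁅y⁆∪⁅z⁆ x∈ = [ x≢y ∘ x∈⁅y⁆⇒x≡y y , x≢z ∘ x∈⁅y⁆⇒x≡y z ] (x∈p∪q⁻ ⁅ y ⁆ ⁅ z ⁆ x∈)

∈⁅x⁆∪p : ∀ {m} (x : Fin m) (p : Subset m) → x ∈ ⁅ x ⁆ ∪ p
∈⁅x⁆∪p x _ = x∈p∪q⁺ (inj₁ (x∈⁅x⁆ x))

∈p⇒∈⁅x⁆∪p : ∀ {m} (x : Fin m) {p : Subset m} {y} → y ∈ p → y ∈ ⁅ x ⁆ ∪ p
∈p⇒∈⁅x⁆∪p _ y∈p = x∈p∪q⁺ (inj₂ y∈p)

⁅x⁆-all : ∀ {m} {P : Fin m → Set} {x} → P x → ∀ {y} → y ∈ ⁅ x ⁆ → P y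
⁅x⁆-all {P = P} {x} Px y∈⁅x⁆ = subst P (sym (x∈⁅y⁆⇒x≡y x y∈⁅x⁆)) Px

⁅x⁆∪p-all : ∀ {m} {P : Fin m → Set} {x p} → P x → (∀ {y} → y ∈ p → P y) →
            ∀ {y} → y ∈ ⁅ x ⁆ ∪ p → P y
⁅x⁆∪p-all {x = x} {p} Px all-p y∈ = [ ⁅x⁆-all Px , all-p ] (x∈p∪q⁻ ⁅ x ⁆ p y∈)

-- PSD forcing in an arbitrary graph

module _ {n : ℕ} (Adj : Fin n → Fin n → Set) where

  data Reach : ℕ → Fin n → Fin n → Set where
    start : ∀ {t s} → Reach t s s
    step : ∀ {t s u v} → Reach t s u → Adj u v → Reach (suc t) s v

  reach-suc : ∀ {t s v} → Reach t s v → Reach (suc t) s v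
  reach-suc start = start
  reach-suc (step r uv) = step (reach-suc r) uv

  blue⇒reach : ∀ {S t v} → Blue Adj S t v → ∃[ s ] (s ∈ S × Reach t s v)
  blue⇒reach {t = zero} {v} v∈S = v , v∈S , start
  blue⇒reach {t = suc t} (inj₁ b) with blue⇒reach b
  ... | s , s∈S , r = s , s∈S , reach-suc r
  blue⇒reach {t = suc t} (inj₂ (_ , u , bu , _ , uv , _)) with blue⇒reach bu
  ... | s , s∈S , r = s , s∈S , step r uv

  ∈⇒blue : ∀ {S s} t → s ∈ S → Blue Adj S t s
  ∈⇒blue zero s∈S = s∈S
  ∈⇒blue (suc t) s∈S = inj₁ (∈⇒blue t s∈S)

  forcingSet⇒atLeastZplus : ∀ {S} → IsPSDForcingSet Adj S → AtLeastZplus Adj S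
  forcingSet⇒atLeastZplus {S} forcing z (_ , minimal) = minimal S forcing

  -- The minimality of the propagation time of the witness is inherited from the lower bound.
  isThrottleX-intro : ∀ {k} → (∀ S p → AllBlue Adj S p → k ≤ ∣ S ∣ * (1 + p)) →
                      ∀ S p → 0 < ∣ S ∣ → AllBlue Adj S p → ∣ S ∣ * (1 + p) ≡ k → IsThrottleX Adj k
  isThrottleX-intro bound S p 0<∣S∣ all ∣S∣[1+p]≡k =
    (S , p , forcingSet⇒atLeastZplus (p , all) , (all , earlier-not-all) , ∣S∣[1+p]≡k) ,
    λ S′ p′ _ (all′ , _) → bound S′ p′ all′
    where
    instance _ = >-nonZero 0<∣S∣
    earlier-not-all : ∀ q → q < p → ¬ AllBlue Adj S q
    earlier-not-all q q<p allq =
      <⇒≱ (*-monoʳ-< ∣ S ∣ (s≤s q<p)) (≤-trans (≤-reflexive ∣S∣[1+p]≡k) (bound S q allq))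

-- Arithmetic modulo d

module Modulo (d : ℕ) .{{_ : NonZero d}} where

  [m%d+n]%d≡[m+n]%d : ∀ m n → (m % d + n) % d ≡ (m + n) % d
  [m%d+n]%d≡[m+n]%d m n = begin
    (m % d + n) % d         ≡⟨ %-distribˡ-+ (m % d) n d ⟩
    (m % d % d + n % d) % d ≡⟨ cong (λ r → (r + n % d) % d) (m%n%n≡m%n m d) ⟩
    (m % d + n % d) % d     ≡⟨ %-distribˡ-+ m n d ⟨
    (m + n) % d             ∎
    where open ≡-Reasoning

  [m+n%d]%d≡[m+n]%d : ∀ m n → (m + n % d) % d ≡ (m + n) % d
  [m+n%d]%d≡[m+n]%d m n = begin
    (m + n % d) % d ≡⟨ cong (_% d) (+-comm m (n % d)) ⟩
    (n % d + m) % d ≡⟨ [m%d+n]%d≡[m+n]%d n m ⟩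
    (n + m) % d     ≡⟨ cong (_% d) (+-comm n m) ⟩
    (m + n) % d     ∎
    where open ≡-Reasoning

  %-congˡ-+ : ∀ {m n} o → m % d ≡ n % d → (m + o) % d ≡ (n + o) % d
  %-congˡ-+ {m} {n} o m≡n = begin
    (m + o) % d     ≡⟨ [m%d+n]%d≡[m+n]%d m o ⟨
    (m % d + o) % d ≡⟨ cong (λ r → (r + o) % d) m≡n ⟩
    (n % d + o) % d ≡⟨ [m%d+n]%d≡[m+n]%d n o ⟩
    (n + o) % d     ∎
    where open ≡-Reasoning

  [m+k+[d∸k%d]]%d≡m%d : ∀ m k → (m + k + (d ∸ k % d)) % d ≡ m % d
  [m+k+[d∸k%d]]%d≡m%d m k = begin
    (m + k + (d ∸ k % d)) % d           ≡⟨ cong (_% d) (+-assoc m k _) ⟩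
    (m + (k + (d ∸ k % d))) % d         ≡⟨ cong (λ r → (m + r) % d) k+[d∸k%d]≡[1+k/d]*d ⟩
    (m + suc (k / d) * d) % d           ≡⟨ [m+kn]%n≡m%n m (suc (k / d)) d ⟩
    m % d                               ∎
    where
    open ≡-Reasoning
    k+[d∸k%d]≡[1+k/d]*d : k + (d ∸ k % d) ≡ suc (k / d) * d
    k+[d∸k%d]≡[1+k/d]*d = begin
      k + (d ∸ k % d)                     ≡⟨ cong (_+ (d ∸ k % d)) (m≡m%n+[m/n]*n k d) ⟩
      k % d + k / d * d + (d ∸ k % d)     ≡⟨ +-assoc (k % d) _ _ ⟩
      k % d + (k / d * d + (d ∸ k % d))   ≡⟨ cong (k % d +_) (+-comm (k / d * d) _) ⟩
      k % d + ((d ∸ k % d) + k / d * d)   ≡⟨ +-assoc (k % d) _ _ ⟨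
      k % d + (d ∸ k % d) + k / d * d     ≡⟨ cong (_+ k / d * d) (m+[n∸m]≡n (m%n≤n k d)) ⟩
      d + k / d * d                       ∎

  [m+k]%d≡[n+k]%d⇒m≡n : ∀ {m n} k → m < d → n < d → (m + k) % d ≡ (n + k) % d → m ≡ n
  [m+k]%d≡[n+k]%d⇒m≡n {m} {n} k m<d n<d eq = begin
    m                                  ≡⟨ m<n⇒m%n≡m m<d ⟨
    m % d                              ≡⟨ [m+k+[d∸k%d]]%d≡m%d m k ⟨
    (m + k + (d ∸ k % d)) % d          ≡⟨ %-congˡ-+ (d ∸ k % d) eq ⟩
    (n + k + (d ∸ k % d)) % d          ≡⟨ [m+k+[d∸k%d]]%d≡m%d n k ⟩
    n % d                              ≡⟨ m<n⇒m%n≡m n<d ⟩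
    n                                  ∎
    where open ≡-Reasoning

-- The cycle C_n

module Cycle {n : ℕ} (3≤n : 3 ≤ n) where

  instance
    n≢0 : NonZero n
    n≢0 = >-nonZero (≤-trans (s≤s z≤n) 3≤n)

  open Modulo n

  1<n : 1 < n
  1<n = ≤-trans (s≤s (s≤s z≤n)) 3≤n

  suc[n-1]≡n : suc (n ∸ 1) ≡ n
  suc[n-1]≡n = m+[n∸m]≡n (<⇒≤ 1<n)

  n-1<n : n ∸ 1 < n
  n-1<n = ≤-reflexive suc[n-1]≡n

  1<n-1 : 1 < n ∸ 1
  1<n-1 = s≤s⁻¹ (subst (2 <_) (sym suc[n-1]≡n) 3≤n)

  Step : Fin n → Fin n → Set
  Step a b = suc (toℕ a) % n ≡ toℕ b

  suc%n : ∀ {a} → a < n → suc a % n ≡ suc a ⊎ (suc a ≡ n × suc a % n ≡ 0)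
  suc%n a<n with m≤n⇒m<n∨m≡n a<n
  ... | inj₁ 1+a<n = inj₁ (m<n⇒m%n≡m 1+a<n)
  ... | inj₂ refl = inj₂ (refl , n%n≡0 n)

  adj⇒step : ∀ {a b} → CycleAdj n a b → Step a b ⊎ Step b a
  adj⇒step {a} {b} (inj₁ eq) = inj₁ (trans (m<n⇒m%n≡m (subst (_< n) (sym eq) (toℕ<n b))) eq)
  adj⇒step {a} {b} (inj₂ (inj₁ eq)) = inj₂ (trans (m<n⇒m%n≡m (subst (_< n) (sym eq) (toℕ<n a))) eq)
  adj⇒step (inj₂ (inj₂ (inj₁ (a≡0 , 1+b≡n)))) = inj₂ (trans (cong (_% n) 1+b≡n) (trans (n%n≡0 n) (sym a≡0)))
  adj⇒step (inj₂ (inj₂ (inj₂ (b≡0 , 1+a≡n)))) = inj₁ (trans (cong (_% n) 1+a≡n) (trans (n%n≡0 n) (sym b≡0)))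

  step⇒adj : ∀ {a b} → Step a b → CycleAdj n a b
  step⇒adj {a} st with suc%n (toℕ<n a)
  ... | inj₁ eq = inj₁ (trans (sym eq) st)
  ... | inj₂ (1+a≡n , 1+a%n≡0) = inj₂ (inj₂ (inj₂ (trans (sym st) 1+a%n≡0 , 1+a≡n)))

  adj-sym : ∀ {a b} → CycleAdj n a b → CycleAdj n b a
  adj-sym (inj₁ eq) = inj₂ (inj₁ eq)
  adj-sym (inj₂ (inj₁ eq)) = inj₁ eq
  adj-sym (inj₂ (inj₂ (inj₁ eq))) = inj₂ (inj₂ (inj₂ eq))
  adj-sym (inj₂ (inj₂ (inj₂ eq))) = inj₂ (inj₂ (inj₁ eq))

  offset : Fin n → Fin n → ℕ
  offset u w = (toℕ w + (n ∸ toℕ u)) % n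

  offset<n : ∀ u w → offset u w < n
  offset<n u w = m%n<n _ n

  offset-injective : ∀ u {w w′} → offset u w ≡ offset u w′ → w ≡ w′
  offset-injective u {w} {w′} eq = toℕ-injective ([m+k]%d≡[n+k]%d⇒m≡n (n ∸ toℕ u) (toℕ<n w) (toℕ<n w′) eq)

  offset-self : ∀ u → offset u u ≡ 0
  offset-self u = trans (cong (_% n) (m+[n∸m]≡n (<⇒≤ (toℕ<n u)))) (n%n≡0 n)

  offset-step : ∀ u {w y} → Step w y → offset u y ≡ suc (offset u w) % n
  offset-step u {w} {y} st = begin
    (toℕ y + c) % n             ≡⟨ cong (λ r → (r + c) % n) st ⟨
    (suc (toℕ w) % n + c) % n   ≡⟨ [m%d+n]%d≡[m+n]%d (suc (toℕ w)) c ⟩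
    (1 + (toℕ w + c)) % n       ≡⟨ [m+n%d]%d≡[m+n]%d 1 (toℕ w + c) ⟨
    (1 + offset u w) % n        ∎
    where
    open ≡-Reasoning
    c = n ∸ toℕ u

  ahead : Fin n → ℕ → Fin n
  ahead u k = fromℕ< (m%n<n (toℕ u + k) n)

  toℕ-ahead : ∀ u k → toℕ (ahead u k) ≡ (toℕ u + k) % n
  toℕ-ahead u k = toℕ-fromℕ< (m%n<n (toℕ u + k) n)

  offset-ahead : ∀ u {k} → k < n → offset u (ahead u k) ≡ k
  offset-ahead u {k} k<n = begin
    (toℕ (ahead u k) + (n ∸ toℕ u)) % n      ≡⟨ cong (λ r → (r + (n ∸ toℕ u)) % n) (toℕ-ahead u k) ⟩
    ((toℕ u + k) % n + (n ∸ toℕ u)) % n   ≡⟨ [m%d+n]%d≡[m+n]%d (toℕ u + k) _ ⟩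
    (toℕ u + k + (n ∸ toℕ u)) % n         ≡⟨ cong (_% n) (+-comm (toℕ u + k) _) ⟩
    ((n ∸ toℕ u) + (toℕ u + k)) % n       ≡⟨ cong (_% n) (+-assoc (n ∸ toℕ u) (toℕ u) k) ⟨
    ((n ∸ toℕ u) + toℕ u + k) % n         ≡⟨ cong (λ r → (r + k) % n) (m∸n+n≡m (<⇒≤ (toℕ<n u))) ⟩
    (n + k) % n                           ≡⟨ cong (_% n) (+-comm n k) ⟩
    (k + n) % n                           ≡⟨ [m+n]%n≡m%n k n ⟩
    k % n                                 ≡⟨ m<n⇒m%n≡m k<n ⟩
    k                                     ∎
    where open ≡-Reasoning

  step-ahead : ∀ u k → Step (ahead u k) (ahead u (suc k))
  step-ahead u k = begin
    suc (toℕ (ahead u k)) % n     ≡⟨ cong (λ r → suc r % n) (toℕ-ahead u k) ⟩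
    (1 + (toℕ u + k) % n) % n  ≡⟨ [m+n%d]%d≡[m+n]%d 1 (toℕ u + k) ⟩
    suc (toℕ u + k) % n        ≡⟨ cong (_% n) (+-suc (toℕ u) k) ⟨
    (toℕ u + suc k) % n        ≡⟨ toℕ-ahead u (suc k) ⟨
    toℕ (ahead u (suc k))         ∎
    where open ≡-Reasoning

  adj-offsets : ∀ u {w y} → CycleAdj n w y → offset u w ≢ 0 → offset u y ≢ 0 →
                offset u y ≡ suc (offset u w) ⊎ offset u w ≡ suc (offset u y)
  adj-offsets u {w} {y} wy w≢u y≢u with adj⇒step wy
  ... | inj₁ st with suc%n (offset<n u w)
  ...   | inj₁ eq = inj₁ (trans (offset-step u st) eq)
  ...   | inj₂ (_ , eq) = contradiction (trans (offset-step u st) eq) y≢u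
  adj-offsets u {w} {y} wy w≢u y≢u | inj₂ st with suc%n (offset<n u y)
  ...   | inj₁ eq = inj₂ (trans (offset-step u st) eq)
  ...   | inj₂ (_ , eq) = contradiction (trans (offset-step u st) eq) w≢u

  neighbour-offset : ∀ u {v} → CycleAdj n u v → offset u v ≡ 1 ⊎ suc (offset u v) ≡ n
  neighbour-offset u {v} uv with adj⇒step uv
  ... | inj₁ st = inj₁ (trans (offset-step u st) (trans (cong (λ r → suc r % n) (offset-self u)) (m<n⇒m%n≡m 1<n)))
  ... | inj₂ st with suc%n (offset<n u v)
  ...   | inj₁ eq = contradiction (trans (sym (offset-self u)) (trans (offset-step u st) eq)) 0≢1+n
  ...   | inj₂ (1+o≡n , _) = inj₂ 1+o≡n

  neighbours : ∀ u {v} → CycleAdj n u v → v ≡ ahead u 1 ⊎ v ≡ ahead u (n ∸ 1)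
  neighbours u {v} uv with neighbour-offset u uv
  ... | inj₁ v1 = inj₁ (offset-injective u (trans v1 (sym (offset-ahead u 1<n))))
  ... | inj₂ vl = inj₂ (offset-injective u (suc-injective (begin
    suc (offset u v)               ≡⟨ vl ⟩
    n                              ≡⟨ suc[n-1]≡n ⟨
    suc (n ∸ 1)                    ≡⟨ cong suc (offset-ahead u n-1<n) ⟨
    suc (offset u (ahead u (n ∸ 1)))  ∎)))
    where open ≡-Reasoning

  whiteEdge-sym : ∀ (B : Fin n → Set) {x y} → WhiteEdge (CycleAdj n) B x y → WhiteEdge (CycleAdj n) B y x
  whiteEdge-sym B (¬Bx , ¬By , xy) = ¬By , ¬Bx , adj-sym xy

  first≢last : ∀ u → ahead u 1 ≢ ahead u (n ∸ 1)
  first≢last u eq = <⇒≢ 1<n-1 (trans (sym (offset-ahead u 1<n)) (trans (cong (offset u) eq) (offset-ahead u n-1<n)))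

  first≢self : ∀ u → ahead u 1 ≢ u
  first≢self u eq = 0≢1+n (trans (sym (offset-self u)) (trans (cong (offset u) (sym eq)) (offset-ahead u 1<n)))

  adj-first : ∀ u → CycleAdj n u (ahead u 1)
  adj-first u = step⇒adj (trans (cong (_% n) (+-comm 1 (toℕ u))) (sym (toℕ-ahead u 1)))

  adj-last : ∀ u → CycleAdj n u (ahead u (n ∸ 1))
  adj-last u = adj-sym (step⇒adj (subst (Step (ahead u (n ∸ 1))) ahead-u-n≡u (step-ahead u (n ∸ 1))))
    where
    ahead-u-n≡u : ahead u (suc (n ∸ 1)) ≡ u
    ahead-u-n≡u = toℕ-injective (begin
      toℕ (ahead u (suc (n ∸ 1)))   ≡⟨ toℕ-ahead u (suc (n ∸ 1)) ⟩
      (toℕ u + suc (n ∸ 1)) % n  ≡⟨ cong (λ m → (toℕ u + m) % n) suc[n-1]≡n ⟩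
      (toℕ u + n) % n            ≡⟨ [m+n]%n≡m%n (toℕ u) n ⟩
      toℕ u % n                  ≡⟨ m<n⇒m%n≡m (toℕ<n u) ⟩
      toℕ u                      ∎)
      where open ≡-Reasoning

  -- Two blue vertices cut C_n into two arcs, and the two neighbours of u lie on different arcs.
  two-blue⇒canForce : ∀ (B : Fin n → Set) {u c v} → B u → B c → c ≢ u → ¬ B v → CycleAdj n u v →
                      CanForce (CycleAdj n) B u v
  two-blue⇒canForce B {u} {c} {v} Bu Bc c≢u ¬Bv uv = Bu , ¬Bv , uv , unique
    where
    oc = offset u c

    oc≢0 : oc ≢ 0
    oc≢0 eq = c≢u (offset-injective u (trans eq (sym (offset-self u))))

    white≢0 : ∀ {x} → ¬ B x → offset u x ≢ 0
    white≢0 ¬Bx eq = ¬Bx (subst B (offset-injective u (trans (offset-self u) (sym eq))) Bu)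

    white≢c : ∀ {x} → ¬ B x → offset u x ≢ oc
    white≢c ¬Bx eq = ¬Bx (subst B (offset-injective u (sym eq)) Bc)

    Lo : Fin n → Set
    Lo x = offset u x < oc

    lo-step : ∀ {x y} → WhiteEdge (CycleAdj n) B x y → Lo x → Lo y
    lo-step (¬Bx , ¬By , xy) lx with adj-offsets u xy (white≢0 ¬Bx) (white≢0 ¬By)
    ... | inj₁ eq = ≤∧≢⇒< (subst (_≤ oc) (sym eq) lx) (white≢c ¬By)
    ... | inj₂ eq = <-trans (≤-reflexive (sym eq)) lx

    lo-path : ∀ {x y} → SameComp (CycleAdj n) B x y → Lo x → Lo y
    lo-path = fold (λ x y → Lo x → Lo y) (λ e f → f ∘ lo-step e) id

    lo-first : ∀ {x} → ¬ B x → offset u x ≡ 1 → Lo x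
    lo-first ¬Bx o≡1 = subst (_< oc) (sym o≡1) (≤∧≢⇒< (n≢0⇒n>0 oc≢0) (λ 1≡oc → white≢c ¬Bx (trans o≡1 1≡oc)))

    ¬lo-last : ∀ {x} → suc (offset u x) ≡ n → ¬ Lo x
    ¬lo-last 1+o≡n lx = <⇒≱ (offset<n u c) (subst (_≤ oc) 1+o≡n lx)

    unique : ∀ w → ¬ B w → SameComp (CycleAdj n) B v w → CycleAdj n u w → w ≡ v
    unique w ¬Bw vw uw with neighbour-offset u uv | neighbour-offset u uw
    ... | inj₁ v1 | inj₁ w1 = offset-injective u (trans w1 (sym v1))
    ... | inj₂ vl | inj₂ wl = offset-injective u (suc-injective (trans wl (sym vl)))
    ... | inj₁ v1 | inj₂ wl = contradiction (lo-path vw (lo-first ¬Bv v1)) (¬lo-last wl)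
    ... | inj₂ vl | inj₁ w1 = contradiction (lo-path (reverse (whiteEdge-sym B) vw) (lo-first ¬Bw w1)) (¬lo-last vl)

  module _ (B : Fin n → Set) {u : Fin n} (only : ∀ w → B w → w ≡ u) where

    private
      white : ∀ {k} → 0 < k → k < n → ¬ B (ahead u k)
      white 0<k k<n Bk =
        <⇒≢ 0<k (trans (sym (offset-self u)) (trans (cong (offset u) (sym (only _ Bk))) (offset-ahead u k<n)))

      arc : ∀ d {k} → 0 < k → k + d < n → SameComp (CycleAdj n) B (ahead u k) (ahead u (k + d))
      arc zero {k} _ _ = subst (λ j → SameComp (CycleAdj n) B (ahead u k) (ahead u j)) (sym (+-identityʳ k)) ε
      arc (suc d) {k} 0<k k+[1+d]<n =
        (white 0<k (≤-<-trans (m≤m+n k (suc d)) k+[1+d]<n) , white (s≤s z≤n) (≤-<-trans (m≤m+n (suc k) d) 1+k+d<n) ,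
         step⇒adj (step-ahead u k))
        ◅ subst (λ j → SameComp (CycleAdj n) B (ahead u (suc k)) (ahead u j)) (sym (+-suc k d)) (arc d (s≤s z≤n) 1+k+d<n)
        where
        1+k+d<n : suc k + d < n
        1+k+d<n = subst (_< n) (+-suc k d) k+[1+d]<n

      around : SameComp (CycleAdj n) B (ahead u 1) (ahead u (n ∸ 1))
      around = subst (λ j → SameComp (CycleAdj n) B (ahead u 1) (ahead u j)) 1+[n-2]≡n-1
                     (arc (n ∸ 2) (s≤s z≤n) (subst (_< n) (sym 1+[n-2]≡n-1) n-1<n))
        where
        1+[n-2]≡n-1 : 1 + (n ∸ 2) ≡ n ∸ 1
        1+[n-2]≡n-1 = sym (+-∸-assoc 1 1<n)

    -- The white arc through all vertices other than u joins the two neighbours of u.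
    lone-blue⇒¬forced : ∀ v → ¬ Forced (CycleAdj n) B v
    lone-blue⇒¬forced v (¬Bv , u′ , Bu′ , _ , u′v , unique) with only u′ Bu′
    ... | refl with neighbours u u′v
    ...   | inj₁ refl = first≢last u (sym (unique (ahead u (n ∸ 1)) (white (<-trans z<s 1<n-1) n-1<n) around (adj-last u)))
    ...   | inj₂ refl = first≢last u (unique (ahead u 1) (white z<s 1<n) (reverse (whiteEdge-sym B) around) (adj-first u))

  displacement : ∀ {t s v} → Reach (CycleAdj n) t s v → ∃[ e ] (e ≤ 2 * t × (toℕ v + t) % n ≡ (toℕ s + e) % n)
  displacement {t} start = t , m≤m+n t (t + 0) , refl
  displacement {suc t} {s} {v} (step {u = u} r uv) with displacement r | adj⇒step uv
  ... | e , e≤2t , eq | inj₁ st = e + 2 , e+2≤2[1+t] , (begin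
    (toℕ v + suc t) % n             ≡⟨ cong (λ r → (r + suc t) % n) st ⟨
    (suc (toℕ u) % n + suc t) % n   ≡⟨ [m%d+n]%d≡[m+n]%d (suc (toℕ u)) (suc t) ⟩
    (suc (toℕ u) + suc t) % n       ≡⟨ cong (_% n) ([1+a]+[1+t]≡a+t+2 (toℕ u) t) ⟩
    (toℕ u + t + 2) % n             ≡⟨ %-congˡ-+ 2 eq ⟩
    (toℕ s + e + 2) % n             ≡⟨ cong (_% n) (+-assoc (toℕ s) e 2) ⟩
    (toℕ s + (e + 2)) % n           ∎)
    where
    open ≡-Reasoning
    [1+a]+[1+t]≡a+t+2 : ∀ a t → suc a + suc t ≡ a + t + 2
    [1+a]+[1+t]≡a+t+2 = solve-∀
    e+2≤2[1+t] : e + 2 ≤ 2 * suc t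
    e+2≤2[1+t] = ≤-trans (+-monoˡ-≤ 2 e≤2t) (≤-reflexive (trans (+-comm (2 * t) 2) (sym (*-suc 2 t))))
  ... | e , e≤2t , eq | inj₂ st = e , ≤-trans e≤2t (*-monoʳ-≤ 2 (n≤1+n t)) , (begin
    (toℕ v + suc t) % n             ≡⟨ cong (_% n) (+-suc (toℕ v) t) ⟩
    (suc (toℕ v) + t) % n           ≡⟨ [m%d+n]%d≡[m+n]%d (suc (toℕ v)) t ⟨
    (suc (toℕ v) % n + t) % n       ≡⟨ cong (λ r → (r + t) % n) st ⟩
    (toℕ u + t) % n                 ≡⟨ eq ⟩
    (toℕ s + e) % n                 ∎)
    where open ≡-Reasoning

  record Anchor (S : Subset n) (p : ℕ) (v : Fin n) : Set where
    field
      seed : Fin n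
      seed∈S : seed ∈ S
      shift : ℕ
      shift≤2p : shift ≤ 2 * p
      shift-eq : (toℕ v + p) % n ≡ (toℕ seed + shift) % n

  blue⇒anchor : ∀ {S p v} → Blue (CycleAdj n) S p v → Anchor S p v
  blue⇒anchor b with blue⇒reach (CycleAdj n) b
  ... | s , s∈S , r with displacement r
  ...   | e , e≤2p , eq = record { seed = s ; seed∈S = s∈S ; shift = e ; shift≤2p = e≤2p ; shift-eq = eq }

  -- A vertex is determined by its seed and its shift.
  allBlue⇒n≤∣S∣*[1+2p] : ∀ {S p} → AllBlue (CycleAdj n) S p → n ≤ ∣ S ∣ * (1 + 2 * p)
  allBlue⇒n≤∣S∣*[1+2p] {S} {p} all = injective⇒≤ code-injective
    where
    open Anchor
    anchor : ∀ v → Anchor S p v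
    anchor v = blue⇒anchor (all v)

    code : Fin n → Fin (∣ S ∣ * (1 + 2 * p))
    code v = combine (rank (seed∈S (anchor v))) (fromℕ< (s≤s (shift≤2p (anchor v))))

    code-injective : ∀ {v w} → code v ≡ code w → v ≡ w
    code-injective {v} {w} eq with combine-injective _ _ _ _ eq
    ... | rank≡ , shift≡ = toℕ-injective ([m+k]%d≡[n+k]%d⇒m≡n p (toℕ<n v) (toℕ<n w) (begin
      (toℕ v + p) % n                                   ≡⟨ shift-eq (anchor v) ⟩
      (toℕ (seed (anchor v)) + shift (anchor v)) % n   ≡⟨ cong₂ (λ s e → (toℕ s + e) % n) seed≡ e≡ ⟩
      (toℕ (seed (anchor w)) + shift (anchor w)) % n   ≡⟨ shift-eq (anchor w) ⟨
      (toℕ w + p) % n                                   ∎))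
      where
      open ≡-Reasoning
      seed≡ : seed (anchor v) ≡ seed (anchor w)
      seed≡ = rank-injective (seed∈S (anchor v)) (seed∈S (anchor w)) rank≡
      e≡ : shift (anchor v) ≡ shift (anchor w)
      e≡ = trans (sym (toℕ-fromℕ< (s≤s (shift≤2p (anchor v)))))
                 (trans (cong toℕ shift≡) (toℕ-fromℕ< (s≤s (shift≤2p (anchor w)))))

  allBlue⇒2≤∣S∣ : ∀ {S p} → AllBlue (CycleAdj n) S p → 2 ≤ ∣ S ∣
  allBlue⇒2≤∣S∣ {S} {p} all = ≮⇒≥ ∣S∣≮2
    where
    open Anchor (blue⇒anchor (all (fromℕ< 1<n)))

    ∣S∣≮2 : ¬ ∣ S ∣ < 2
    ∣S∣≮2 ∣S∣<2 = first≢self seed (only p (ahead seed 1) (all (ahead seed 1)))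
      where
      only : ∀ t w → Blue (CycleAdj n) S t w → w ≡ seed
      only zero w w∈S = ∣p∣≤1⇒∈-unique (≤-pred ∣S∣<2) w∈S seed∈S
      only (suc t) w (inj₁ b) = only t w b
      only (suc t) w (inj₂ f) = contradiction f (lone-blue⇒¬forced (Blue (CycleAdj n) S t) (only t) w)

  Near : Subset n → ℕ → ℕ → Set
  Near S t x = ∃[ s ] (s ∈ S × x ≤ toℕ s + t × toℕ s ≤ x + t)

  near? : ∀ S t x → Dec (Near S t x)
  near? S t x = any? λ s → (s ∈? S) ×-dec ((x ≤? toℕ s + t) ×-dec (toℕ s ≤? x + t))

  near-suc : ∀ {S t x} → Near S t x → Near S (suc t) x
  near-suc {t = t} (s , s∈S , x≤s+t , s≤x+t) =
    s , s∈S , ≤-trans x≤s+t (+-monoʳ-≤ _ (n≤1+n t)) , ≤-trans s≤x+t (+-monoʳ-≤ _ (n≤1+n t))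

  inward : ∀ {S t v} → ¬ Near S t (toℕ v) → Near S (suc t) (toℕ v) → ∃[ u ] (Near S t (toℕ u) × CycleAdj n u v)
  inward {S} {t} {v} ¬near (s , s∈S , v≤s+1+t , s≤v+1+t) with toℕ v ≤? toℕ s + t
  ... | yes v≤s+t = u , (s , s∈S , ≤-trans (≤-reflexive toℕu≡1+v) (≤-trans 1+v≤s (m≤m+n _ t)) ,
                         ≤-reflexive (trans s≡1+v+t (cong (_+ t) (sym toℕu≡1+v)))) ,
                    inj₂ (inj₁ (sym toℕu≡1+v))
    where
    s≡1+v+t : toℕ s ≡ suc (toℕ v + t)
    s≡1+v+t = ≤-antisym (≤-trans s≤v+1+t (≤-reflexive (+-suc (toℕ v) t)))
                        (≰⇒> λ s≤v+t → ¬near (s , s∈S , v≤s+t , s≤v+t))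
    1+v≤s : suc (toℕ v) ≤ toℕ s
    1+v≤s = ≤-trans (s≤s (m≤m+n (toℕ v) t)) (≤-reflexive (sym s≡1+v+t))
    u = fromℕ< (≤-<-trans 1+v≤s (toℕ<n s))
    toℕu≡1+v : toℕ u ≡ suc (toℕ v)
    toℕu≡1+v = toℕ-fromℕ< (≤-<-trans 1+v≤s (toℕ<n s))
  ... | no v≰s+t = u , (s , s∈S , ≤-reflexive toℕu≡s+t ,
                         ≤-trans (≤-trans (m≤m+n (toℕ s) t) (≤-reflexive (sym toℕu≡s+t))) (m≤m+n (toℕ u) t)) ,
                    inj₁ (trans (cong suc toℕu≡s+t) (sym v≡1+s+t))
    where
    v≡1+s+t : toℕ v ≡ suc (toℕ s + t)
    v≡1+s+t = ≤-antisym (≤-trans v≤s+1+t (≤-reflexive (+-suc (toℕ s) t))) (≰⇒> v≰s+t)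
    s+t<n : toℕ s + t < n
    s+t<n = ≤-<-trans (n≤1+n _) (subst (_< n) v≡1+s+t (toℕ<n v))
    u = fromℕ< s+t<n
    toℕu≡s+t : toℕ u ≡ toℕ s + t
    toℕu≡s+t = toℕ-fromℕ< s+t<n

  Fits : ℕ → Fin n → Set
  Fits p s = p ≤ toℕ s × toℕ s + p < n

  -- When no seed is within distance p of the point where the cycle closes up, the blue vertices
  -- at time t ≤ p are exactly those within distance t of a seed.
  module Windows (S : Subset n) (p : ℕ) (fits : ∀ {s} → s ∈ S → Fits p s) where

    blue⇒near : ∀ {t v} → t ≤ p → Blue (CycleAdj n) S t v → Near S t (toℕ v)
    blue⇒near {zero} {v} _ v∈S = v , v∈S , m≤m+n _ 0 , m≤m+n _ 0
    blue⇒near {suc t} 1+t≤p (inj₁ b) = near-suc (blue⇒near (<⇒≤ 1+t≤p) b)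
    blue⇒near {suc t} {v} 1+t≤p (inj₂ (_ , u , Bu , _ , uv , _)) with blue⇒near (<⇒≤ 1+t≤p) Bu
    ... | s , s∈S , u≤s+t , s≤u+t with uv
    ...   | inj₁ 1+u≡v = s , s∈S ,
            subst (_≤ toℕ s + suc t) 1+u≡v (≤-trans (s≤s u≤s+t) (≤-reflexive (sym (+-suc (toℕ s) t)))) ,
            ≤-trans s≤u+t (+-mono-≤ (subst (toℕ u ≤_) 1+u≡v (n≤1+n (toℕ u))) (n≤1+n t))
    ...   | inj₂ (inj₁ 1+v≡u) = s , s∈S ,
            ≤-trans (n≤1+n (toℕ v)) (≤-trans (≤-reflexive 1+v≡u) (≤-trans u≤s+t (+-monoʳ-≤ (toℕ s) (n≤1+n t)))) ,
            ≤-trans s≤u+t (≤-reflexive (trans (cong (_+ t) (sym 1+v≡u)) (sym (+-suc (toℕ v) t))))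
    ...   | inj₂ (inj₂ (inj₁ (u≡0 , _))) =
            contradiction (≤-trans s≤u+t (≤-reflexive (cong (_+ t) u≡0))) (<⇒≱ (<-≤-trans 1+t≤p (proj₁ (fits s∈S))))
    ...   | inj₂ (inj₂ (inj₂ (_ , 1+u≡n))) =
            contradiction (proj₂ (fits s∈S)) (≤⇒≯ (begin
              n                 ≡⟨ 1+u≡n ⟨
              suc (toℕ u)       ≤⟨ s≤s u≤s+t ⟩
              suc (toℕ s + t)   ≡⟨ +-suc (toℕ s) t ⟨
              toℕ s + suc t     ≤⟨ +-monoʳ-≤ (toℕ s) 1+t≤p ⟩
              toℕ s + p         ∎))
      where open ≤-Reasoning

    module _ {a b} (a∈S : a ∈ S) (b∈S : b ∈ S) (a≢b : a ≢ b) where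

      another-blue : ∀ t u → ∃[ c ] (Blue (CycleAdj n) S t c × c ≢ u)
      another-blue t u with u ≟ᶠ a
      ... | yes refl = b , ∈⇒blue (CycleAdj n) t b∈S , (λ b≡a → a≢b (sym b≡a))
      ... | no u≢a = a , ∈⇒blue (CycleAdj n) t a∈S , (λ a≡u → u≢a (sym a≡u))

      near⇒blue : ∀ {t v} → t ≤ p → Near S t (toℕ v) → Blue (CycleAdj n) S t v
      near⇒blue {zero} {v} _ (s , s∈S , v≤s , s≤v) =
        subst (_∈ S) (toℕ-injective (≤-antisym (≤-trans s≤v (≤-reflexive (+-identityʳ _)))
                                                (≤-trans v≤s (≤-reflexive (+-identityʳ _))))) s∈S
      near⇒blue {suc t} {v} 1+t≤p near with near? S t (toℕ v)
      ... | yes near′ = inj₁ (near⇒blue (<⇒≤ 1+t≤p) near′)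
      ... | no ¬near′ with inward ¬near′ near
      ...   | u , near-u , uv with another-blue t u
      ...     | c , Bc , c≢u = inj₂ (¬Bv , u , two-blue⇒canForce (Blue (CycleAdj n) S t) Bu Bc c≢u ¬Bv uv)
        where
        Bu = near⇒blue (<⇒≤ 1+t≤p) near-u
        ¬Bv = λ Bv → ¬near′ (blue⇒near (<⇒≤ 1+t≤p) Bv)

      covered⇒allBlue : (∀ v → Near S p (toℕ v)) → AllBlue (CycleAdj n) S p
      covered⇒allBlue covered v = near⇒blue ≤-refl (covered v)

  module _ (p o : ℕ) (o+w≤n : o + (1 + 2 * p) ≤ n) where

    private
      p+o+p≡o+2p : ∀ p o → p + o + p ≡ o + 2 * p
      p+o+p≡o+2p = solve-∀

      p+o+p<n : p + o + p < n
      p+o+p<n = ≤-trans (≤-reflexive (trans (cong suc (p+o+p≡o+2p p o)) (sym (+-suc o (2 * p))))) o+w≤n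

    -- The centre of the window [o, o + 1 + 2p) of radius p.
    centre : Fin n
    centre = fromℕ< (≤-<-trans (m≤m+n (p + o) p) p+o+p<n)

    toℕ-centre : toℕ centre ≡ p + o
    toℕ-centre = toℕ-fromℕ< (≤-<-trans (m≤m+n (p + o) p) p+o+p<n)

    centre-fits : Fits p centre
    centre-fits = subst (λ c → p ≤ c × c + p < n) (sym toℕ-centre) (m≤m+n p o , p+o+p<n)

    centre-near : ∀ {S x} → centre ∈ S → o ≤ x → x < o + (1 + 2 * p) → Near S p x
    centre-near {x = x} c∈S o≤x x<o+w = centre , c∈S ,
      subst (λ c → x ≤ c + p) (sym toℕ-centre) (≤-trans (≤-pred (≤-trans x<o+w (≤-reflexive (+-suc o (2 * p)))))
                                                         (≤-reflexive (sym (p+o+p≡o+2p p o)))) ,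
      subst (_≤ x + p) (sym toℕ-centre) (≤-trans (≤-reflexive (+-comm p o)) (+-monoˡ-≤ p o≤x))

  centres-distinct : ∀ p {o o′} (fits : o + (1 + 2 * p) ≤ n) (fits′ : o′ + (1 + 2 * p) ≤ n) →
                     o < o′ → centre p o fits ≢ centre p o′ fits′
  centres-distinct p fits fits′ o<o′ eq =
    <⇒≢ (+-monoʳ-< p o<o′) (trans (sym (toℕ-centre p _ fits)) (trans (cong toℕ eq) (toℕ-centre p _ fits′)))

  twoSeeds : ∀ {p} → 2 * p + 2 ≤ n → n ≤ 4 * p + 2 → ∃[ S ] (∣ S ∣ ≡ 2 × AllBlue (CycleAdj n) S p)
  twoSeeds {p} room tight =
    ⁅ A ⁆ ∪ ⁅ B ⁆ ,
    ∣⁅x⁆∪⁅y⁆∣≡2 A≢B ,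
    covered⇒allBlue A∈ B∈ A≢B cover
    where
    w = 1 + 2 * p
    w<n : w < n
    w<n = ≤-trans (≤-reflexive (+-comm 2 (2 * p))) room
    o = n ∸ w
    fitsA : 0 + w ≤ n
    fitsA = <⇒≤ w<n
    fitsB : o + w ≤ n
    fitsB = ≤-reflexive (m∸n+n≡m fitsA)
    A = centre p 0 fitsA
    B = centre p o fitsB
    A≢B : A ≢ B
    A≢B = centres-distinct p fitsA fitsB (m<n⇒0<n∸m w<n)
    S = ⁅ A ⁆ ∪ ⁅ B ⁆
    A∈ : A ∈ S
    A∈ = ∈⁅x⁆∪p A _
    B∈ : B ∈ S
    B∈ = ∈p⇒∈⁅x⁆∪p A (x∈⁅x⁆ B)
    open Windows S p (⁅x⁆∪p-all {P = Fits p} (centre-fits p 0 fitsA) (⁅x⁆-all {P = Fits p} (centre-fits p o fitsB)))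
    cover : ∀ v → Near S p (toℕ v)
    cover v with toℕ v <? w
    ... | yes v<w = centre-near p 0 fitsA A∈ z≤n v<w
    ... | no v≮w = centre-near p o fitsB B∈
      (m≤n+o⇒m∸n≤o n w (≤-trans tight (≤-trans (≤-reflexive (4p+2≡w+w p)) (+-monoʳ-≤ w (≮⇒≥ v≮w)))))
      (subst (toℕ v <_) (sym (m∸n+n≡m fitsA)) (toℕ<n v))
      where
      4p+2≡w+w : ∀ p → 4 * p + 2 ≡ (1 + 2 * p) + (1 + 2 * p)
      4p+2≡w+w = solve-∀

  threeSeeds : ∀ {p} → 3 * (1 + 2 * p) ≡ n → ∃[ S ] (∣ S ∣ ≡ 3 × AllBlue (CycleAdj n) S p)
  threeSeeds {p} 3w≡n =
    ⁅ A ⁆ ∪ (⁅ B ⁆ ∪ ⁅ C ⁆) ,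
    ∣⁅x⁆∪⁅y⁆∪⁅z⁆∣≡3 A≢B A≢C B≢C ,
    covered⇒allBlue A∈ B∈ A≢B cover
    where
    w = 1 + 2 * p
    w+w+w≡n : w + w + w ≡ n
    w+w+w≡n = trans (w+w+w≡3w p) 3w≡n
      where
      w+w+w≡3w : ∀ p → (1 + 2 * p) + (1 + 2 * p) + (1 + 2 * p) ≡ 3 * (1 + 2 * p)
      w+w+w≡3w = solve-∀
    fitsC : (w + w) + w ≤ n
    fitsC = ≤-reflexive w+w+w≡n
    fitsB : w + w ≤ n
    fitsB = ≤-trans (m≤m+n (w + w) w) fitsC
    fitsA : 0 + w ≤ n
    fitsA = ≤-trans (m≤m+n w w) fitsB
    A = centre p 0 fitsA
    B = centre p w fitsB
    C = centre p (w + w) fitsC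
    0<w : 0 < w
    0<w = s≤s z≤n
    A≢B : A ≢ B
    A≢B = centres-distinct p fitsA fitsB 0<w
    B≢C : B ≢ C
    B≢C = centres-distinct p fitsB fitsC (subst (_< w + w) (+-identityʳ w) (+-monoʳ-< w 0<w))
    A≢C : A ≢ C
    A≢C = centres-distinct p fitsA fitsC (≤-trans 0<w (m≤m+n w w))
    S = ⁅ A ⁆ ∪ (⁅ B ⁆ ∪ ⁅ C ⁆)
    A∈ : A ∈ S
    A∈ = ∈⁅x⁆∪p A _
    B∈ : B ∈ S
    B∈ = ∈p⇒∈⁅x⁆∪p A (∈⁅x⁆∪p B _)
    C∈ : C ∈ S
    C∈ = ∈p⇒∈⁅x⁆∪p A (∈p⇒∈⁅x⁆∪p B (x∈⁅x⁆ C))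
    open Windows S p (⁅x⁆∪p-all {P = Fits p} (centre-fits p 0 fitsA)
                       (⁅x⁆∪p-all {P = Fits p} (centre-fits p w fitsB) (⁅x⁆-all {P = Fits p} (centre-fits p (w + w) fitsC))))
    cover : ∀ v → Near S p (toℕ v)
    cover v with toℕ v <? w | toℕ v <? w + w
    ... | yes v<w | _ = centre-near p 0 fitsA A∈ z≤n v<w
    ... | no v≮w | yes v<2w = centre-near p w fitsB B∈ (≮⇒≥ v≮w) v<2w
    ... | no _ | no v≮2w = centre-near p (w + w) fitsC C∈ (≮⇒≥ v≮2w) (subst (toℕ v <_) (sym w+w+w≡n) (toℕ<n v))

  isThrottleX-byCounting : ∀ {k} → (∀ {S p} → 2 ≤ ∣ S ∣ → n ≤ ∣ S ∣ * (1 + 2 * p) → k ≤ ∣ S ∣ * (1 + p)) →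
                           ∀ S p → AllBlue (CycleAdj n) S p → ∣ S ∣ * (1 + p) ≡ k → IsThrottleX (CycleAdj n) k
  isThrottleX-byCounting bound S p all =
    isThrottleX-intro (CycleAdj n) (λ S p all → bound {S} {p} (allBlue⇒2≤∣S∣ all) (allBlue⇒n≤∣S∣*[1+2p] all))
                      S p (≤-trans (s≤s z≤n) (allBlue⇒2≤∣S∣ all)) all

cycle-throttleX-special : ∀ i → IsThrottleX (CycleAdj (12 * i + 3)) (3 * (1 + ceilDiv (12 * i + 3 ∸ 3) 6))
cycle-throttleX-special i rewrite ⌈[n-3]/6⌉-special i =
  let S , ∣S∣≡3 , all = threeSeeds {2 * i} (3[1+2[2i]]≡12i+3 i)
  in isThrottleX-byCounting (special-bound {i}) S (2 * i) all (cong (_* (1 + 2 * i)) ∣S∣≡3)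
  where
  open Cycle (m≤n+m 3 (12 * i))
  3[1+2[2i]]≡12i+3 : ∀ i → 3 * (1 + 2 * (2 * i)) ≡ 12 * i + 3
  3[1+2[2i]]≡12i+3 = solve-∀

cycle-throttleX-nonSpecial : ∀ {n} → 4 ≤ n → ¬ Special n → IsThrottleX (CycleAdj n) (2 * (1 + ceilDiv (n ∸ 2) 4))
cycle-throttleX-nonSpecial {n} 4≤n ¬special =
  let S , ∣S∣≡2 , all = twoSeeds {x} (⌈[n-2]/4⌉-room 4≤n) (⌈[n-2]/4⌉-upper n)
  in isThrottleX-byCounting (nonSpecial-bound {n} 4≤n ¬special) S x all (cong (_* (1 + x)) ∣S∣≡2)
  where
  open Cycle (<⇒≤ 4≤n)
  x = ⌈[n-2]/4⌉ n

mainTheorem11 : (n : ℕ) → 4 ≤ n →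
    ((∃[ i ] (1 ≤ i × n ≡ 12 * i + 3)) →
       IsThrottleX (CycleAdj n) (3 * (1 + ceilDiv (n ∸ 3) 6)))
    × ((¬ (∃[ i ] (1 ≤ i × n ≡ 12 * i + 3))) →
       IsThrottleX (CycleAdj n) (2 * (1 + ceilDiv (n ∸ 2) 4)))
mainTheorem11 n 4≤n =
  (λ (i , _ , n≡12i+3) → subst (λ m → IsThrottleX (CycleAdj m) (3 * (1 + ceilDiv (m ∸ 3) 6)))
                                (sym n≡12i+3) (cycle-throttleX-special i)) ,
  cycle-throttleX-nonSpecial 4≤n
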